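{- Up to isomorphism, there is exactly one Steinitz-Rademacher polyhedron of cardinality 6, namely the structure $M_6$ with domain $\{v_0,v_1,e_0,e_1,f_0,f_1\}$, where $V=\{v_0,v_1\}$, $E=\{e_0,e_1\}$, $F=\{f_0,f_1\}$, and $I$ is the symmetric relation in which every vertex is incident with every edge and every face, every edge is incident with every face, and no other pairs are incident.
   Context: Let $\pi$ be the unsorted first-order signature with equality consisting of three unary predicates $V$ ("vertex"), $E$ ("edge"), $F$ ("face") and one binary relation $I$ ("incidence"). The theory $\mathsf{SR}$ consists of the following $\pi$-sentences: (1) there is at least one vertex, at least one edge, and at least one face; (2) every element satisfies $V$, $E$, or $F$; (3) $I$ is symmetric; (4) no two vertices are incident with each other, no two edges are incident with each other, and no two faces are incident with each other; (5) for all $v,e,f$, if $V(v)$, $E(e)$, $F(f)$, $I(v,e)$ and $I(e,f)$, then $I(v,f)$; (6) every edge is incident with exactly two vertices; (7) every edge is incident with exactly two faces; (8) whenever $V(v)$, $F(f)$ and $I(v,f)$, there are exactly two edges incident with both $v$ and $f$; (9) every vertex and every face is incident with at least one other element. A Steinitz-Rademacher polyhedron is a $\pi$-structure satisfying all sentences of $\mathsf{SR}$; its cardinality is the cardinality of its domain. -}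

module Defs where

open import Data.Bool using (Bool; true; false; T; not)
open import Data.Fin using (Fin; zero; suc)
open import Data.Product using (Σ; ∃; ∃-syntax; _×_; _,_)
open import Data.Sum using (_⊎_)
open import Relation.Nullary using (¬_)
open import Relation.Binary.PropositionalEquality using (_≡_; _≢_)
open import Function.Bundles using (_⤖_; Bijection)

-- A π-structure (classical first-order semantics: relations are
-- Bool-valued, i.e. genuine subsets / binary relations of the domain).
record πStructure : Set₁ where
  field
    Carrier : Set
    V E F   : Carrier → Bool
    I       : Carrier → Carrier → Bool

ExactlyTwo : {A : Set} → (A → Set) → Set
ExactlyTwo {A} P =
  Σ A λ x → Σ A λ y → x ≢ y × P x × P y × (∀ z → P z → z ≡ x ⊎ z ≡ y)

record IsSR (M : πStructure) : Set where
  open πStructure M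
  field
    ax1 : (∃[ v ] T (V v)) × (∃[ e ] T (E e)) × (∃[ f ] T (F f))
    ax2 : ∀ x → T (V x) ⊎ T (E x) ⊎ T (F x)
    ax3 : ∀ x y → T (I x y) → T (I y x)
    ax4 : (∀ x y → T (V x) → T (V y) → ¬ T (I x y))
        × (∀ x y → T (E x) → T (E y) → ¬ T (I x y))
        × (∀ x y → T (F x) → T (F y) → ¬ T (I x y))
    ax5 : ∀ v e f → T (V v) → T (E e) → T (F f) → T (I v e) → T (I e f) → T (I v f)
    ax6 : ∀ e → T (E e) → ExactlyTwo (λ v → T (V v) × T (I e v))
    ax7 : ∀ e → T (E e) → ExactlyTwo (λ f → T (F f) × T (I e f))
    ax8 : ∀ v f → T (V v) → T (F f) → T (I v f)
        → ExactlyTwo (λ e → T (E e) × T (I v e) × T (I e f))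
    ax9 : ∀ x → T (V x) ⊎ T (F x) → ∃[ y ] (y ≢ x × T (I x y))

record _≅_ (M N : πStructure) : Set where
  private
    module M = πStructure M
    module N = πStructure N
  field
    bij   : M.Carrier ⤖ N.Carrier
  open Bijection bij using (to)
  field
    presV : ∀ x → M.V x ≡ N.V (to x)
    presE : ∀ x → M.E x ≡ N.E (to x)
    presF : ∀ x → M.F x ≡ N.F (to x)
    presI : ∀ x y → M.I x y ≡ N.I (to x) (to y)

HasCard : πStructure → (n : _) → Set
HasCard M n = πStructure.Carrier M ⤖ Fin n

-- M₆: elements 0,1 = v₀,v₁ ; 2,3 = e₀,e₁ ; 4,5 = f₀,f₁.
data Sort : Set where vS eS fS : Sort

sort6 : Fin 6 → Sort
sort6 zero = vS
sort6 (suc zero) = vS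
sort6 (suc (suc zero)) = eS
sort6 (suc (suc (suc zero))) = eS
sort6 (suc (suc (suc (suc zero)))) = fS
sort6 (suc (suc (suc (suc (suc zero))))) = fS

isV isE isF : Sort → Bool
isV vS = true
isV _  = false
isE eS = true
isE _  = false
isF fS = true
isF _  = false

diffSort : Sort → Sort → Bool
diffSort vS vS = false
diffSort eS eS = false
diffSort fS fS = false
diffSort _  _  = true

M₆ : πStructure
M₆ = record
  { Carrier = Fin 6
  ; V = λ x → isV (sort6 x)
  ; E = λ x → isE (sort6 x)
  ; F = λ x → isF (sort6 x)
  ; I = λ x y → diffSort (sort6 x) (sort6 y)
  }

-- Sorts are disjoint in a Steinitz-Rademacher polyhedron, and every sort has
-- at least two elements: an edge has two vertices and two faces, and a flag
-- (v , f) lies on two edges.  With six elements every sort therefore has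
-- exactly two, so each edge meets both vertices and both faces, and by
-- axiom (5) each vertex meets each face: the incidence is "different sorts",
-- as in M₆.  Conversely, any structure whose incidence is "different sorts"
-- with exactly two elements of each sort satisfies SR.
module Submission where

open import Defs
open import Data.Nat using (ℕ; suc)
open import Data.Nat.Properties using (n<1+n)
open import Data.Product using (Σ; ∃-syntax; _×_; _,_; proj₁; proj₂)
open import Data.Bool using (Bool; true; false; T)
open import Data.Unit using (tt)
open import Data.Empty using (⊥-elim)
open import Data.Sum using (_⊎_; inj₁; inj₂)
open import Data.Fin using (Fin; zero; suc)
open import Data.Fin.Patterns using (0F; 1F; 2F; 3F; 4F; 5F)
open import Data.Fin.Properties using (any?; <⇒notInjective)
import Data.Fin.Properties as Fin
open import Function using (_∘_)
open import Function.Bundles using (_⤖_; Bijection; mk↔ₛ′)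
open import Function.Definitions using (Injective; StrictlySurjective)
open import Function.Properties.Inverse using (↔⇒⤖)
open import Function.Construct.Identity using (⤖-id)
open import Relation.Nullary using (¬_; yes; no; contradiction)
open import Relation.Nullary.Decidable using (via-injection)
open import Relation.Binary.PropositionalEquality
open ≡-Reasoning

T-extensional : {a b : Bool} → (T a → T b) → (T b → T a) → a ≡ b
T-extensional {false} {false} _   _   = refl
T-extensional {false} {true}  _   b⇒a = ⊥-elim (b⇒a tt)
T-extensional {true}  {false} a⇒b _   = ⊥-elim (a⇒b tt)
T-extensional {true}  {true}  _   _   = refl

injective⇒surjective : {A : Set} {n : ℕ} → A ⤖ Fin n →
                       (f : Fin n → A) → Injective _≡_ _≡_ f →
                       StrictlySurjective _≡_ f
injective⇒surjective {A} {n} g f f-injective z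
  with any? (λ i → via-injection (Bijection.injection g) Fin._≟_ (f i) z)
... | yes hit = hit
... | no miss = contradiction (λ {i j} → extend-injective {i} {j}) (<⇒notInjective (n<1+n n))
  where
  open Bijection g using (to; injective)

  extend : Fin (suc n) → Fin n
  extend zero    = to z
  extend (suc i) = to (f i)

  extend-injective : Injective _≡_ _≡_ extend
  extend-injective {zero}  {zero}  _ = refl
  extend-injective {zero}  {suc j} p = ⊥-elim (miss (j , sym (injective p)))
  extend-injective {suc i} {zero}  p = ⊥-elim (miss (i , injective p))
  extend-injective {suc i} {suc j} p = cong suc (f-injective (injective p))

module _ {A : Set} where

  AtLeastTwo : (A → Set) → Set
  AtLeastTwo P = Σ (Bool → A) λ pick → Injective _≡_ _≡_ pick × (∀ b → P (pick b))

  AtMostTwo : (A → Set) → Set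
  AtMostTwo P = Σ A λ a → Σ A λ b → ∀ z → P z → z ≡ a ⊎ z ≡ b

  ExactlyTwo-map : {P Q : A → Set} → (∀ z → P z → Q z) → (∀ z → Q z → P z) →
                   ExactlyTwo P → ExactlyTwo Q
  ExactlyTwo-map P⇒Q Q⇒P (x , y , x≢y , Px , Py , only) =
    x , y , x≢y , P⇒Q x Px , P⇒Q y Py , λ z → only z ∘ Q⇒P z

  ExactlyTwo⇒AtLeastTwo : {P Q : A → Set} → (∀ z → P z → Q z) →
                          ExactlyTwo P → AtLeastTwo Q
  ExactlyTwo⇒AtLeastTwo {Q = Q} P⇒Q (x , y , x≢y , Px , Py , _) =
    pick , pick-injective , Q-pick
    where
    pick : Bool → A
    pick false = x
    pick true  = y

    pick-injective : Injective _≡_ _≡_ pick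
    pick-injective {false} {false} _ = refl
    pick-injective {false} {true}  p = ⊥-elim (x≢y p)
    pick-injective {true}  {false} p = ⊥-elim (x≢y (sym p))
    pick-injective {true}  {true}  _ = refl

    Q-pick : ∀ b → Q (pick b)
    Q-pick false = P⇒Q x Px
    Q-pick true  = P⇒Q y Py

  ExactlyTwo-fills : {P Q : A → Set} → ExactlyTwo P → (∀ z → P z → Q z) →
                     AtMostTwo Q → ∀ z → Q z → P z
  ExactlyTwo-fills (x , y , x≢y , Px , Py , _) P⇒Q (a , b , covers) z Qz
    with covers x (P⇒Q x Px) | covers y (P⇒Q y Py) | covers z Qz
  ... | inj₁ refl | inj₁ refl | _         = ⊥-elim (x≢y refl)
  ... | inj₂ refl | inj₂ refl | _         = ⊥-elim (x≢y refl)
  ... | inj₁ refl | inj₂ refl | inj₁ refl = Px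
  ... | inj₁ refl | inj₂ refl | inj₂ refl = Py
  ... | inj₂ refl | inj₁ refl | inj₁ refl = Py
  ... | inj₂ refl | inj₁ refl | inj₂ refl = Px

isSort : Sort → Sort → Bool
isSort vS = isV
isSort eS = isE
isSort fS = isF

isSort-refl : ∀ t → T (isSort t t)
isSort-refl vS = tt
isSort-refl eS = tt
isSort-refl fS = tt

isSort-sound : ∀ t {u} → T (isSort t u) → u ≡ t
isSort-sound vS {vS} _ = refl
isSort-sound vS {eS} ()
isSort-sound vS {fS} ()
isSort-sound eS {vS} ()
isSort-sound eS {eS} _ = refl
isSort-sound eS {fS} ()
isSort-sound fS {vS} ()
isSort-sound fS {eS} ()
isSort-sound fS {fS} _ = refl

diffSort-irreflexive : ∀ t → ¬ T (diffSort t t)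
diffSort-irreflexive vS ()
diffSort-irreflexive eS ()
diffSort-irreflexive fS ()

diffSort-sound : ∀ {t u} → T (diffSort t u) → t ≢ u
diffSort-sound {t} d refl = diffSort-irreflexive t d

diffSort-complete : ∀ {t u} → t ≢ u → T (diffSort t u)
diffSort-complete {vS} {vS} t≢u = ⊥-elim (t≢u refl)
diffSort-complete {vS} {eS} _   = tt
diffSort-complete {vS} {fS} _   = tt
diffSort-complete {eS} {vS} _   = tt
diffSort-complete {eS} {eS} t≢u = ⊥-elim (t≢u refl)
diffSort-complete {eS} {fS} _   = tt
diffSort-complete {fS} {vS} _   = tt
diffSort-complete {fS} {eS} _   = tt
diffSort-complete {fS} {fS} t≢u = ⊥-elim (t≢u refl)

predOf : (M : πStructure) → Sort → πStructure.Carrier M → Bool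
predOf M vS = πStructure.V M
predOf M eS = πStructure.E M
predOf M fS = πStructure.F M

-- The sort map s presents M as the complete tripartite structure on the fibres of s.
record SortedBy (M : πStructure) (s : πStructure.Carrier M → Sort) : Set where
  open πStructure M
  field
    pred-sort : ∀ t x → predOf M t x ≡ isSort t (s x)
    I-sort    : ∀ x y → I x y ≡ diffSort (s x) (s y)

M₆-sortedBy : SortedBy M₆ sort6
M₆-sortedBy = record
  { pred-sort = λ { vS _ → refl ; eS _ → refl ; fS _ → refl }
  ; I-sort    = λ _ _ → refl
  }

sort6-fibres : ∀ t → ExactlyTwo (λ i → sort6 i ≡ t)
sort6-fibres vS = 0F , 1F , (λ ()) , refl , refl ,
  λ { 0F _ → inj₁ refl ; 1F _ → inj₂ refl ; 2F () ; 3F () ; 4F () ; 5F () }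
sort6-fibres eS = 2F , 3F , (λ ()) , refl , refl ,
  λ { 0F () ; 1F () ; 2F _ → inj₁ refl ; 3F _ → inj₂ refl ; 4F () ; 5F () }
sort6-fibres fS = 4F , 5F , (λ ()) , refl , refl ,
  λ { 0F () ; 1F () ; 2F () ; 3F () ; 4F _ → inj₁ refl ; 5F _ → inj₂ refl }

≅-viaSorts : ∀ {M N s t} → SortedBy M s → SortedBy N t →
             (b : πStructure.Carrier M ⤖ πStructure.Carrier N) →
             (∀ x → t (Bijection.to b x) ≡ s x) → M ≅ N
≅-viaSorts {M} {N} {s} {t} sortedM sortedN b sort-preserved = record
  { bij   = b
  ; presV = pred-preserved vS
  ; presE = pred-preserved eS
  ; presF = pred-preserved fS
  ; presI = λ x y → begin
      πStructure.I M x y              ≡⟨ M.I-sort x y ⟩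
      diffSort (s x) (s y)            ≡⟨ sym (cong₂ diffSort (sort-preserved x)
                                                             (sort-preserved y)) ⟩
      diffSort (t (to x)) (t (to y))  ≡⟨ sym (N.I-sort (to x) (to y)) ⟩
      πStructure.I N (to x) (to y)    ∎
  }
  where
  module M = SortedBy sortedM
  module N = SortedBy sortedN
  open Bijection b using (to)

  pred-preserved : ∀ u x → predOf M u x ≡ predOf N u (to x)
  pred-preserved u x = begin
    predOf M u x            ≡⟨ M.pred-sort u x ⟩
    isSort u (s x)          ≡⟨ sym (cong (isSort u) (sort-preserved x)) ⟩
    isSort u (t (to x))     ≡⟨ sym (N.pred-sort u (to x)) ⟩
    predOf N u (to x)       ∎

module _ {M : πStructure} {s : πStructure.Carrier M → Sort} (sorted : SortedBy M s) where
  open πStructure M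
  open SortedBy sorted

  private
    has-sort : ∀ t {x} → T (predOf M t x) → s x ≡ t
    has-sort t {x} = isSort-sound t ∘ subst T (pred-sort t x)

    sort-has : ∀ t {x} → s x ≡ t → T (predOf M t x)
    sort-has t {x} refl = subst T (sym (pred-sort t x)) (isSort-refl t)

    incident⇒differentSorts : ∀ {x y} → T (I x y) → s x ≢ s y
    incident⇒differentSorts {x} {y} = diffSort-sound ∘ subst T (I-sort x y)

    differentSorts⇒incident : ∀ {x y} → s x ≢ s y → T (I x y)
    differentSorts⇒incident {x} {y} = subst T (sym (I-sort x y)) ∘ diffSort-complete

    incident-by-sorts : ∀ {x y t u} → s x ≡ t → s y ≡ u → t ≢ u → T (I x y)
    incident-by-sorts refl refl = differentSorts⇒incident

  sorted⇒SR : (∀ t → ExactlyTwo (λ x → s x ≡ t)) → IsSR M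
  sorted⇒SR fibres = record
    { ax1 = inhabited vS , inhabited eS , inhabited fS
    ; ax2 = classify
    ; ax3 = λ _ _ → differentSorts⇒incident ∘ ≢-sym ∘ incident⇒differentSorts
    ; ax4 = (λ _ _ → same-sort vS) , (λ _ _ → same-sort eS) , (λ _ _ → same-sort fS)
    ; ax5 = λ _ _ _ v∶V _ f∶F _ _ →
        incident-by-sorts (has-sort vS v∶V) (has-sort fS f∶F) (λ ())
    ; ax6 = λ e e∶E → ExactlyTwo-map
        (λ v v∶V → sort-has vS v∶V , incident-by-sorts (has-sort eS e∶E) v∶V (λ ()))
        (λ _ → has-sort vS ∘ proj₁) (fibres vS)
    ; ax7 = λ e e∶E → ExactlyTwo-map
        (λ f f∶F → sort-has fS f∶F , incident-by-sorts (has-sort eS e∶E) f∶F (λ ()))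
        (λ _ → has-sort fS ∘ proj₁) (fibres fS)
    ; ax8 = λ v f v∶V f∶F _ → ExactlyTwo-map
        (λ e e∶E → sort-has eS e∶E , incident-by-sorts (has-sort vS v∶V) e∶E (λ ())
                                   , incident-by-sorts e∶E (has-sort fS f∶F) (λ ()))
        (λ _ → has-sort eS ∘ proj₁) (fibres eS)
    ; ax9 = λ { x (inj₁ x∶V) → edge-neighbour (has-sort vS x∶V) (λ ())
              ; x (inj₂ x∶F) → edge-neighbour (has-sort fS x∶F) (λ ()) }
    }
    where
    inhabited : ∀ t → ∃[ x ] T (predOf M t x)
    inhabited t = let (x , _ , _ , x∶t , _) = fibres t in x , sort-has t x∶t

    classify : ∀ x → T (V x) ⊎ T (E x) ⊎ T (F x)
    classify x with s x in x∶t
    ... | vS = inj₁ (sort-has vS x∶t)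
    ... | eS = inj₂ (inj₁ (sort-has eS x∶t))
    ... | fS = inj₂ (inj₂ (sort-has fS x∶t))

    same-sort : ∀ t {x y} → T (predOf M t x) → T (predOf M t y) → ¬ T (I x y)
    same-sort t x∶t y∶t x~y =
      incident⇒differentSorts x~y (trans (has-sort t x∶t) (sym (has-sort t y∶t)))

    edge-neighbour : ∀ {x t} → s x ≡ t → t ≢ eS → ∃[ y ] (y ≢ x × T (I x y))
    edge-neighbour x∶t t≢eS with fibres eS
    ... | y , _ , _ , y∶E , _ =
      y , (λ { refl → t≢eS (trans (sym x∶t) y∶E) }) , incident-by-sorts x∶t y∶E t≢eS

module SR {M : πStructure} (sr : IsSR M) where
  open πStructure M
  open IsSR sr

  vertex-not-edge : ∀ x → T (V x) → ¬ T (E x)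
  vertex-not-edge x x∶V x∶E with ax6 x x∶E
  ... | v , _ , _ , (v∶V , x~v) , _ = proj₁ ax4 x v x∶V v∶V x~v

  edge-not-face : ∀ x → T (E x) → ¬ T (F x)
  edge-not-face x x∶E x∶F with ax7 x x∶E
  ... | f , _ , _ , (f∶F , x~f) , _ = proj₂ (proj₂ ax4) x f x∶F f∶F x~f

  -- A neighbour y of x is a vertex, a face, or an edge; in the last case
  -- axiom (5) makes x incident with itself.
  vertex-not-face : ∀ x → T (V x) → ¬ T (F x)
  vertex-not-face x x∶V x∶F with ax9 x (inj₁ x∶V)
  ... | y , _ , x~y with ax2 y
  ... | inj₁ y∶V        = proj₁ ax4 x y x∶V y∶V x~y
  ... | inj₂ (inj₂ y∶F) = proj₂ (proj₂ ax4) x y x∶F y∶F x~y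
  ... | inj₂ (inj₁ y∶E) =
    proj₁ ax4 x x x∶V x∶V (ax5 x y x x∶V y∶E x∶F x~y (ax3 x y x~y))

  sort-unique : ∀ {t u x} → T (predOf M t x) → T (predOf M u x) → t ≡ u
  sort-unique {vS} {vS}     _   _   = refl
  sort-unique {vS} {eS} {x} x∶V x∶E = ⊥-elim (vertex-not-edge x x∶V x∶E)
  sort-unique {vS} {fS} {x} x∶V x∶F = ⊥-elim (vertex-not-face x x∶V x∶F)
  sort-unique {eS} {vS} {x} x∶E x∶V = ⊥-elim (vertex-not-edge x x∶V x∶E)
  sort-unique {eS} {eS}     _   _   = refl
  sort-unique {eS} {fS} {x} x∶E x∶F = ⊥-elim (edge-not-face x x∶E x∶F)
  sort-unique {fS} {vS} {x} x∶F x∶V = ⊥-elim (vertex-not-face x x∶V x∶F)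
  sort-unique {fS} {eS} {x} x∶F x∶E = ⊥-elim (edge-not-face x x∶E x∶F)
  sort-unique {fS} {fS}     _   _   = refl

  classify : ∀ x → Σ Sort λ t → T (predOf M t x)
  classify x with ax2 x
  ... | inj₁ x∶V        = vS , x∶V
  ... | inj₂ (inj₁ x∶E) = eS , x∶E
  ... | inj₂ (inj₂ x∶F) = fS , x∶F

  sortOf : Carrier → Sort
  sortOf = proj₁ ∘ classify

  sortOf-unique : ∀ {t x} → T (predOf M t x) → sortOf x ≡ t
  sortOf-unique {x = x} = sort-unique (proj₂ (classify x))

  pred-sortOf : ∀ t x → predOf M t x ≡ isSort t (sortOf x)
  pred-sortOf t x = T-extensional
    (λ x∶t → subst (T ∘ isSort t) (sym (sortOf-unique x∶t)) (isSort-refl t))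
    (λ x∶t → subst (λ u → T (predOf M u x)) (isSort-sound t x∶t) (proj₂ (classify x)))

  same-sort-nonincident : ∀ t {x y} → T (predOf M t x) → T (predOf M t y) → ¬ T (I x y)
  same-sort-nonincident vS = proj₁ ax4 _ _
  same-sort-nonincident eS = proj₁ (proj₂ ax4) _ _
  same-sort-nonincident fS = proj₂ (proj₂ ax4) _ _

  edge : ∃[ e ] T (E e)
  edge = proj₁ (proj₂ ax1)

  flag : Σ Carrier λ v → Σ Carrier λ f → T (V v) × T (F f) × T (I v f)
  flag with edge
  ... | e , e∶E with ax6 e e∶E | ax7 e e∶E
  ... | v , _ , _ , (v∶V , e~v) , _ | f , _ , _ , (f∶F , e~f) , _ =
    v , f , v∶V , f∶F , ax5 v e f v∶V e∶E f∶F (ax3 e v e~v) e~f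

  atLeastTwo : ∀ t → AtLeastTwo (λ x → T (predOf M t x))
  atLeastTwo vS = ExactlyTwo⇒AtLeastTwo (λ _ → proj₁) (ax6 _ (proj₂ edge))
  atLeastTwo fS = ExactlyTwo⇒AtLeastTwo (λ _ → proj₁) (ax7 _ (proj₂ edge))
  atLeastTwo eS = let (v , f , v∶V , f∶F , v~f) = flag in
    ExactlyTwo⇒AtLeastTwo (λ _ → proj₁) (ax8 v f v∶V f∶F v~f)

  module _ (fewVertices : AtMostTwo (T ∘ V)) (fewFaces : AtMostTwo (T ∘ F)) where

    edge-vertex : ∀ {e v} → T (E e) → T (V v) → T (I e v)
    edge-vertex {e} {v} e∶E v∶V =
      proj₂ (ExactlyTwo-fills (ax6 e e∶E) (λ _ → proj₁) fewVertices v v∶V)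

    edge-face : ∀ {e f} → T (E e) → T (F f) → T (I e f)
    edge-face {e} {f} e∶E f∶F =
      proj₂ (ExactlyTwo-fills (ax7 e e∶E) (λ _ → proj₁) fewFaces f f∶F)

    vertex-face : ∀ {v f} → T (V v) → T (F f) → T (I v f)
    vertex-face {v} {f} v∶V f∶F = let (e , e∶E) = edge in
      ax5 v e f v∶V e∶E f∶F (ax3 e v (edge-vertex e∶E v∶V)) (edge-face e∶E f∶F)

    incident-of-sorts : ∀ t u {x y} → T (predOf M t x) → T (predOf M u y) →
                        t ≢ u → T (I x y)
    incident-of-sorts vS vS _   _   t≢u = ⊥-elim (t≢u refl)
    incident-of-sorts vS eS x∶V y∶E _   = ax3 _ _ (edge-vertex y∶E x∶V)
    incident-of-sorts vS fS x∶V y∶F _   = vertex-face x∶V y∶F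
    incident-of-sorts eS vS x∶E y∶V _   = edge-vertex x∶E y∶V
    incident-of-sorts eS eS _   _   t≢u = ⊥-elim (t≢u refl)
    incident-of-sorts eS fS x∶E y∶F _   = edge-face x∶E y∶F
    incident-of-sorts fS vS x∶F y∶V _   = ax3 _ _ (vertex-face y∶V x∶F)
    incident-of-sorts fS eS x∶F y∶E _   = ax3 _ _ (edge-face y∶E x∶F)
    incident-of-sorts fS fS _   _   t≢u = ⊥-elim (t≢u refl)

    I-sortOf : ∀ x y → I x y ≡ diffSort (sortOf x) (sortOf y)
    I-sortOf x y = T-extensional
      (λ x~y → diffSort-complete λ same →
         same-sort-nonincident (sortOf x) (proj₂ (classify x))
           (subst (λ u → T (predOf M u y)) (sym same) (proj₂ (classify y))) x~y)
      (incident-of-sorts (sortOf x) (sortOf y) (proj₂ (classify x)) (proj₂ (classify y))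
        ∘ diffSort-sound)

module SixElements {M : πStructure} (sr : IsSR M) (card : HasCard M 6) where
  open πStructure M
  open SR sr

  pick : Sort → Bool → Carrier
  pick t = proj₁ (atLeastTwo t)

  sortOf-pick : ∀ t b → sortOf (pick t b) ≡ t
  sortOf-pick t b = sortOf-unique (proj₂ (proj₂ (atLeastTwo t)) b)

  sample : Sort × Bool → Carrier
  sample (t , b) = pick t b

  sample-injective : Injective _≡_ _≡_ sample
  sample-injective {t , b} {u , c} eq
    with trans (sym (sortOf-pick t b)) (trans (cong sortOf eq) (sortOf-pick u c))
  ... | refl = cong (t ,_) (proj₁ (proj₂ (atLeastTwo t)) eq)

  label : Fin 6 → Sort × Bool
  label i = sort6 i , second i
    where
    second : Fin 6 → Bool
    second 0F = false
    second 1F = true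
    second 2F = false
    second 3F = true
    second 4F = false
    second 5F = true

  unlabel : Sort × Bool → Fin 6
  unlabel (vS , false) = 0F
  unlabel (vS , true)  = 1F
  unlabel (eS , false) = 2F
  unlabel (eS , true)  = 3F
  unlabel (fS , false) = 4F
  unlabel (fS , true)  = 5F

  unlabel-label : ∀ i → unlabel (label i) ≡ i
  unlabel-label 0F = refl
  unlabel-label 1F = refl
  unlabel-label 2F = refl
  unlabel-label 3F = refl
  unlabel-label 4F = refl
  unlabel-label 5F = refl

  labelled : Fin 6 → Carrier
  labelled = sample ∘ label

  labelled-injective : Injective _≡_ _≡_ labelled
  labelled-injective {i} {j} eq = begin
    i                     ≡⟨ sym (unlabel-label i) ⟩
    unlabel (label i)     ≡⟨ cong unlabel (sample-injective eq) ⟩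
    unlabel (label j)     ≡⟨ unlabel-label j ⟩
    j                     ∎

  labelled-surjective : StrictlySurjective _≡_ labelled
  labelled-surjective = injective⇒surjective card labelled labelled-injective

  index : Carrier → Fin 6
  index = proj₁ ∘ labelled-surjective

  labelled-index : ∀ z → labelled (index z) ≡ z
  labelled-index = proj₂ ∘ labelled-surjective

  index-labelled : ∀ i → index (labelled i) ≡ i
  index-labelled i = labelled-injective (labelled-index (labelled i))

  sort6-index : ∀ z → sort6 (index z) ≡ sortOf z
  sort6-index z = begin
    sort6 (index z)             ≡⟨ sym (sortOf-pick _ _) ⟩
    sortOf (labelled (index z)) ≡⟨ cong sortOf (labelled-index z) ⟩
    sortOf z                    ∎

  sample-surjective : StrictlySurjective _≡_ sample
  sample-surjective z = label (index z) , labelled-index z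

  atMostTwo : ∀ t → AtMostTwo (λ z → T (predOf M t z))
  atMostTwo t = pick t false , pick t true , covered
    where
    covered : ∀ z → T (predOf M t z) → z ≡ pick t false ⊎ z ≡ pick t true
    covered z z∶t with sample-surjective z
    ... | (u , b) , refl with trans (sym (sortOf-pick u b)) (sortOf-unique {t} z∶t)
    ... | refl with b
    ... | false = inj₁ refl
    ... | true  = inj₂ refl

  sortedBy : SortedBy M sortOf
  sortedBy = record
    { pred-sort = pred-sortOf
    ; I-sort    = I-sortOf (atMostTwo vS) (atMostTwo fS)
    }

  ≅M₆ : M ≅ M₆
  ≅M₆ = ≅-viaSorts sortedBy M₆-sortedBy
    (↔⇒⤖ (mk↔ₛ′ index labelled index-labelled labelled-index)) sort6-index

theorem5 : IsSR M₆ × HasCard M₆ 6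
    × ((M : πStructure) → IsSR M → HasCard M 6 → M ≅ M₆)
theorem5 =
    sorted⇒SR M₆-sortedBy sort6-fibres
  , ⤖-id _
  , λ M sr card → SixElements.≅M₆ sr card
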